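{- Let $n$ be an odd composite number with prime factorization $n=p_1^{l_1}\cdots p_k^{l_k}$ (distinct primes $p_j$, exponents $l_j\ge 1$). Then $n$ is an overpseudoprime to base 2 if and only if for every vector of integers $(i_1,\ldots,i_k)$ with $0\le i_j\le l_j$ for all $j$ and not all $i_j=0$, we have $h(n)=h(p_1^{i_1}\cdots p_k^{i_k})$.
   Context: For an odd integer $m>1$, $h(m)$ denotes the multiplicative order of 2 modulo $m$. The cyclotomic cosets of 2 modulo $m$ are the orbits of the set $\{1,2,\ldots,m-1\}$ under the map $x\mapsto 2x \bmod m$; $r(m)$ denotes the number of distinct cyclotomic cosets of 2 modulo $m$. An odd composite number $n$ is called an overpseudoprime to base 2 if $n=r(n)h(n)+1$. -}

module Defs where

open import Data.Nat using (ℕ; zero; suc; _+_; _*_; _^_; _≤_; _<_; _≤ᵇ_)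
open import Data.Nat.DivMod using (_%_)
open import Data.Nat.Primality using (Composite)
open import Data.Fin using (Fin; zero; suc)
open import Data.Bool using (Bool; true; false; if_then_else_; _∧_)
open import Data.Nat using (_≡ᵇ_)
open import Data.List using (List; []; _∷_; upTo; filter; length; foldr; map)
open import Relation.Binary.PropositionalEquality using (_≡_)
open import Data.Product using (_×_)
open import Relation.Nullary.Decidable using (T?)

_mod_ : ℕ → ℕ → ℕ
x mod zero = x
x mod suc m = x % suc m

-- least j in [k, k + fuel] with 2^j ≡ 1 (mod m); 0 if none exists
findOrder : ℕ → ℕ → ℕ → ℕ
findOrder m zero    k = if (2 ^ k) mod m ≡ᵇ 1 mod m then k else 0
findOrder m (suc f) k = if (2 ^ k) mod m ≡ᵇ 1 mod m then k else findOrder m f (suc k)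

-- h(m): multiplicative order of 2 modulo m (for odd m > 1 it exists and is ≤ m),
-- i.e. the least j ≥ 1 with 2^j ≡ 1 (mod m)
h : ℕ → ℕ
h m = findOrder m m 1

-- x is the least element of its cyclotomic coset {x·2^j mod m : j ∈ ℕ}.
-- The sequence j ↦ x·2^j mod m is periodic with period dividing h(m) < m
-- (m odd, m > 1), so j < m covers the whole coset.
isCosetMin : ℕ → ℕ → Bool
isCosetMin m x = foldr (λ j b → (x ≤ᵇ ((x * 2 ^ j) mod m)) ∧ b) true (upTo m)

-- r(m): number of distinct cyclotomic cosets of 2 modulo m on {1, …, m-1},
-- counted via their least elements
r : ℕ → ℕ
r m = length (filter (λ x → T? (isCosetMin m x)) (map suc (upTo (m Data.Nat.∸ 1))))

Odd : ℕ → Set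
Odd n = n % 2 ≡ 1

Overpseudoprime : ℕ → Set
Overpseudoprime n = Odd n × Composite n × (n ≡ r n * h n + 1)

prod : (k : ℕ) → (Fin k → ℕ) → ℕ
prod zero    f = 1
prod (suc k) f = f zero * prod k (λ j → f (suc j))

-- Write N = n and H = h(N). Multiplication by 2 permutes the residues mod N and 2^H acts
-- trivially, so counting the pairs (x, j) with 0 < x < N, j < H and x·2^j the least element
-- of its cyclotomic coset gives H · r(N) = Σ_x c(x), where c(x) ≥ 1 is the number of j < H at
-- which the orbit of x sits at its minimum; c(x) = 1 exactly when x·2^t ≢ x for 0 < t < H,
-- i.e. when the coset of x has H elements. So n is an overpseudoprime iff all cosets are full.
-- If x·2^t ≡ x with 0 < t < H, then d = N / gcd(x, N) > 1 divides both N and 2^t - 1, so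
-- h(d) < H; conversely, if N = e·d with d > 1 then e·2^h(d) ≡ e, so a full coset of e forces
-- h(d) ≥ H, while h(d) ≤ H for every divisor d. Hence all cosets are full iff h(d) = h(N) for
-- every divisor d > 1 of N, and these divisors are the products p₁^i₁ ⋯ p_k^i_k with some iⱼ ≠ 0.

{-# OPTIONS --safe #-}
module Submission where

open import Defs
open import Data.Bool.Base using (Bool; true; false; T; _∧_)
open import Data.Bool.Properties using (T-∧)
open import Data.Empty using (⊥; ⊥-elim)
open import Data.Unit.Base using (tt)
open import Data.Fin.Base using (Fin; toℕ; fromℕ<) renaming (zero to fzero; suc to fsuc)
open import Data.Fin.Permutation using (Permutation; permutation)
import Data.Fin.Properties as Fin
open import Data.List.Base using ([]; _∷_; upTo; applyUpTo; map; filter; length; foldr)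
open import Data.List.Extrema.Nat using (argmin; f[argmin]≤f[xs])
open import Data.List.Membership.Propositional.Properties using (∈-upTo⁺)
open import Data.List.Properties using (map-upTo)
open import Data.List.Relation.Unary.All as All using (All; []; _∷_)
open import Data.Nat.Base
open import Data.Nat.Coprimality using (Coprime; coprime-divisor; coprime-/gcd)
  renaming (sym to coprime-sym)
open import Data.Nat.DivMod renaming (_mod_ to _modᶠ_)
open import Data.Nat.Divisibility
open import Data.Nat.GCD using (gcd; gcd[m,n]∣m; gcd[m,n]∣n; gcd[m,n]≢0)
open import Data.Nat.Primality
  using (Prime; Composite; euclidsLemma; prime⇒irreducible; prime⇒nonTrivial; prime⇒nonZero)
open import Data.Nat.Properties
open import Algebra.Properties.CommutativeMonoid.Sum +-0-commutativeMonoid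
  using (sum-syntax; sum-cong-≗; ∑-distrib-+; ∑-comm; ∑-permute)
open import Data.Product.Base using (∃; ∃₂; _×_; _,_; proj₁; proj₂)
open import Data.Sum.Base using (inj₁; inj₂)
open import Function.Base using (_∘_)
open import Function.Bundles using (_⇔_; mk⇔; Equivalence)
open import Function.Definitions using (Injective)
open import Relation.Binary.Definitions using (tri<; tri≈; tri>)
open import Relation.Binary.PropositionalEquality
open import Relation.Nullary using (¬_; yes; no; contradiction)
open import Relation.Nullary.Decidable using (T?)

open Equivalence using (to; from)

m*n∸m≡m*[n∸1] : ∀ m n → m * n ∸ m ≡ m * (n ∸ 1)
m*n∸m≡m*[n∸1] m n = trans (cong (m * n ∸_) (sym (*-identityʳ m))) (sym (*-distribˡ-∸ m n 1))

%≡%⇒∣∸ : ∀ a b d .{{_ : NonZero d}} → a % d ≡ b % d → d ∣ b ∸ a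
%≡%⇒∣∸ a b d eq = divides (b / d ∸ a / d) (begin
  b ∸ a                                      ≡⟨ cong₂ _∸_ (m≡m%n+[m/n]*n b d) (m≡m%n+[m/n]*n a d) ⟩
  (b % d + b / d * d) ∸ (a % d + a / d * d)  ≡⟨ cong (λ z → (b % d + b / d * d) ∸ (z + a / d * d)) eq ⟩
  (b % d + b / d * d) ∸ (b % d + a / d * d)  ≡⟨ [m+n]∸[m+o]≡n∸o (b % d) _ _ ⟩
  b / d * d ∸ a / d * d                      ≡⟨ *-distribʳ-∸ d (b / d) (a / d) ⟨
  (b / d ∸ a / d) * d                        ∎)
  where open ≡-Reasoning

∣∸⇒%≡% : ∀ {a b} d .{{_ : NonZero d}} → a ≤ b → d ∣ b ∸ a → a % d ≡ b % d
∣∸⇒%≡% {a} {b} d a≤b d∣b∸a = begin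
  a % d            ≡⟨ %-remove-+ʳ a d∣b∸a ⟨
  (a + (b ∸ a)) % d ≡⟨ cong (_% d) (m+[n∸m]≡n a≤b) ⟩
  b % d            ∎
  where open ≡-Reasoning

[m%d]*n%d≡m*n%d : ∀ m n d .{{_ : NonZero d}} → m % d * n % d ≡ m * n % d
[m%d]*n%d≡m*n%d m n d = begin
  m % d * n % d             ≡⟨ %-distribˡ-* (m % d) n d ⟩
  m % d % d * (n % d) % d   ≡⟨ cong (λ z → z * (n % d) % d) (m%n%n≡m%n m d) ⟩
  m % d * (n % d) % d       ≡⟨ %-distribˡ-* m n d ⟨
  m * n % d                 ∎
  where open ≡-Reasoning

odd⇒coprime-2 : ∀ {m} → Odd m → Coprime m 2
odd⇒coprime-2 odd {zero} (_ , 0∣2) with () ← 0∣⇒≡0 0∣2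
odd⇒coprime-2 odd {1} _ = refl
odd⇒coprime-2 {m} odd {2} (2∣m , _) = contradiction (trans (sym (n∣m⇒m%n≡0 m 2 2∣m)) odd) 0≢1+n
odd⇒coprime-2 odd {suc (suc (suc _))} (_ , d∣2) with s≤s (s≤s ()) ← ∣⇒≤ d∣2

odd-∣ : ∀ {d n} → d ∣ n → Odd n → Odd d
odd-∣ {d} {n} d∣n odd with d % 2 in eq | m%n<n d 2
... | 0 | _ = contradiction (trans (sym (n∣m⇒m%n≡0 n 2 (∣-trans (m%n≡0⇒n∣m d 2 eq) d∣n))) odd) 0≢1+n
... | 1 | _ = refl
... | 2+ _ | s≤s (s≤s ())

coprime-divisor-2^ : ∀ {m y} → Coprime m 2 → ∀ a → m ∣ 2 ^ a * y → m ∣ y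
coprime-divisor-2^ {y = y} _ zero m∣y = subst (_ ∣_) (+-identityʳ y) m∣y
coprime-divisor-2^ {m} c (suc a) m∣2^1+a*y =
  coprime-divisor-2^ c a (coprime-divisor c (subst (m ∣_) (*-assoc 2 (2 ^ a) _) m∣2^1+a*y))

*-cofactor-< : ∀ {m e d} → suc m ≡ e * d → 1 < d → 0 < e × e < suc m
*-cofactor-< {e = zero} () _
*-cofactor-< {e = e@(suc _)} {d} m≡e*d 1<d = z<s , subst (e <_) (sym m≡e*d) (m<m*n e d 1<d)

suc≡+1⇔≡ : ∀ {m n} → suc m ≡ n + 1 ⇔ n ≡ m
suc≡+1⇔≡ {m} {n} = mk⇔
  (λ eq → suc-injective (trans (+-comm 1 n) (sym eq)))
  (λ { refl → +-comm 1 m })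

T-foldr-∧ : ∀ (P : ℕ → Bool) xs → T (foldr (λ j b → P j ∧ b) true xs) ⇔ All (T ∘ P) xs
T-foldr-∧ P []       = mk⇔ (λ _ → []) (λ _ → tt)
T-foldr-∧ P (x ∷ xs) = mk⇔
  (λ t → let p , ps = to T-∧ t in p ∷ to (T-foldr-∧ P xs) ps)
  (λ { (p ∷ ps) → from T-∧ (p , from (T-foldr-∧ P xs) ps) })

-- Order of 2

-- Two of 2^0, …, 2^m agree mod m; the power of 2 cancels since m is odd.
odd⇒∃∣2^j∸1 : ∀ {m} .{{_ : NonZero m}} → Odd m → ∃ λ j → 1 ≤ j × j ≤ m × m ∣ 2 ^ j ∸ 1
odd⇒∃∣2^j∸1 {m} odd with Fin.pigeonhole (n<1+n m) (λ i → fromℕ< (m%n<n (2 ^ toℕ i) m))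
... | i , i′ , i<i′ , same-residue = c , m<n⇒0<n∸m i<i′ , c≤m , m∣2^c∸1
  where
  a : ℕ
  a = toℕ i
  c : ℕ
  c = toℕ i′ ∸ a
  c≤m : c ≤ m
  c≤m = ≤-trans (m∸n≤m (toℕ i′) a) (≤-pred (Fin.toℕ<n i′))
  2^a≡2^[a+c] : 2 ^ a % m ≡ 2 ^ (a + c) % m
  2^a≡2^[a+c] = trans (sym (Fin.toℕ-fromℕ< _))
    (trans (cong toℕ same-residue) (trans (Fin.toℕ-fromℕ< _)
      (cong (λ z → 2 ^ z % m) (sym (m+[n∸m]≡n (<⇒≤ i<i′))))))
  m∣2^c∸1 : m ∣ 2 ^ c ∸ 1
  m∣2^c∸1 = coprime-divisor-2^ (odd⇒coprime-2 odd) a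
    (subst (m ∣_) (trans (cong (_∸ 2 ^ a) (^-distribˡ-+-* 2 a c)) (m*n∸m≡m*[n∸1] (2 ^ a) (2 ^ c)))
      (%≡%⇒∣∸ (2 ^ a) (2 ^ (a + c)) m 2^a≡2^[a+c]))

orderTest : ℕ → ℕ → Bool
orderTest m j = (2 ^ j) mod m ≡ᵇ 1 mod m

T-orderTest⇔∣ : ∀ {m} → Odd m → ∀ j → T (orderTest m j) ⇔ m ∣ 2 ^ j ∸ 1
T-orderTest⇔∣ {suc m} _ j = mk⇔
  (λ t → %≡%⇒∣∸ 1 (2 ^ j) (suc m) (sym (≡ᵇ⇒≡ _ _ t)))
  (λ m∣ → ≡⇒≡ᵇ _ _ (sym (∣∸⇒%≡% (suc m) (m^n>0 2 j) m∣)))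

findOrder-least : ∀ m f k {i} → k ≤ i → i < findOrder m f k → ¬ T (orderTest m i)
findOrder-least m zero k k≤i i< with orderTest m k
... | true  = ⊥-elim (<⇒≱ i< k≤i)
... | false = ⊥-elim (n≮0 i<)
findOrder-least m (suc f) k k≤i i< with orderTest m k in eq
... | true  = ⊥-elim (<⇒≱ i< k≤i)
... | false with m≤n⇒m<n∨m≡n k≤i
...   | inj₂ refl = subst T eq
...   | inj₁ k<i  = findOrder-least m f (suc k) k<i i<

findOrder-found : ∀ m f k {j} → k ≤ j → j ≤ f + k → T (orderTest m j) →
                  k ≤ findOrder m f k × T (orderTest m (findOrder m f k))
findOrder-found m zero k k≤j j≤k t with orderTest m k in eq
... | true  = ≤-refl , subst T (sym eq) tt
... | false with refl ← ≤-antisym k≤j j≤k = ⊥-elim (subst T eq t)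
findOrder-found m (suc f) k {j} k≤j j≤ t with orderTest m k in eq
... | true  = ≤-refl , subst T (sym eq) tt
... | false with m≤n⇒m<n∨m≡n k≤j
...   | inj₂ refl = ⊥-elim (subst T eq t)
...   | inj₁ k<j  with findOrder-found m f (suc k) k<j (subst (j ≤_) (sym (+-suc f k)) j≤) t
...     | k<o , found = <⇒≤ k<o , found

h-isOrder : ∀ {m} → Odd m → 1 ≤ h m × m ∣ 2 ^ h m ∸ 1
h-isOrder {zero} ()
h-isOrder {m@(suc _)} odd with j , j>0 , j≤m , m∣ ← odd⇒∃∣2^j∸1 odd
  with h>0 , found ← findOrder-found m m 1 j>0 (≤-trans j≤m (m≤m+n m 1)) (from (T-orderTest⇔∣ odd j) m∣)
  = h>0 , to (T-orderTest⇔∣ odd (h m)) found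

h-least : ∀ {m j} → Odd m → 1 ≤ j → m ∣ 2 ^ j ∸ 1 → h m ≤ j
h-least {m} {j} odd j>0 m∣ = ≮⇒≥ (λ j<h → findOrder-least m m 1 j>0 j<h (from (T-orderTest⇔∣ odd j) m∣))

h≤ : ∀ {m} → Odd m → h m ≤ m
h≤ {zero} ()
h≤ {suc _} odd with j , j>0 , j≤m , m∣ ← odd⇒∃∣2^j∸1 odd = ≤-trans (h-least odd j>0 m∣) j≤m

-- Finite sums and counting

indicator : Bool → ℕ
indicator true  = 1
indicator false = 0

count : ∀ k → (Fin k → Bool) → ℕ
count k b = ∑[ i < k ] indicator (b i)

∑-const : ∀ k c → ∑[ i < k ] c ≡ k * c
∑-const zero    c = refl
∑-const (suc k) c = cong (c +_) (∑-const k c)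

f[i]≤∑ : ∀ {k} (f : Fin k → ℕ) i → f i ≤ ∑[ j < k ] f j
f[i]≤∑ f fzero    = m≤m+n (f fzero) _
f[i]≤∑ f (fsuc i) = ≤-trans (f[i]≤∑ (f ∘ fsuc) i) (m≤n+m _ (f fzero))

f[i]+f[j]≤∑ : ∀ {k} (f : Fin k → ℕ) {i j} → i ≢ j → f i + f j ≤ ∑[ l < k ] f l
f[i]+f[j]≤∑ f {fzero}  {fzero}  i≢j = contradiction refl i≢j
f[i]+f[j]≤∑ f {fzero}  {fsuc j} _   = +-monoʳ-≤ (f fzero) (f[i]≤∑ (f ∘ fsuc) j)
f[i]+f[j]≤∑ f {fsuc i} {fzero}  _   =
  subst (_≤ ∑[ l < _ ] f l) (+-comm (f fzero) _) (+-monoʳ-≤ (f fzero) (f[i]≤∑ (f ∘ fsuc) i))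
f[i]+f[j]≤∑ f {fsuc i} {fsuc j} i≢j =
  ≤-trans (f[i]+f[j]≤∑ (f ∘ fsuc) (i≢j ∘ cong fsuc)) (m≤n+m _ (f fzero))

-- Writing each term as 1 + (f i ∸ 1), the surplus terms sum to 0.
∑≡k⇒all≡1 : ∀ {k} (f : Fin k → ℕ) → (∀ i → 1 ≤ f i) → ∑[ i < k ] f i ≡ k → ∀ i → f i ≡ 1
∑≡k⇒all≡1 {k} f f≥1 ∑f≡k i = begin
  f i           ≡⟨ m+[n∸m]≡n (f≥1 i) ⟨
  1 + (f i ∸ 1) ≡⟨ cong suc (n≤0⇒n≡0 (≤-trans (f[i]≤∑ surplus i) (≤-reflexive ∑surplus≡0))) ⟩
  1             ∎
  where
  open ≡-Reasoning
  surplus : Fin k → ℕ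
  surplus j = f j ∸ 1
  ∑surplus : ℕ
  ∑surplus = ∑[ j < k ] surplus j
  ∑surplus≡0 : ∑surplus ≡ 0
  ∑surplus≡0 = +-cancelˡ-≡ k _ 0 (begin
    k + ∑[ j < k ] surplus j              ≡⟨ cong (_+ ∑surplus) (trans (∑-const k 1) (*-identityʳ k)) ⟨
    ∑[ j < k ] 1 + ∑[ j < k ] surplus j   ≡⟨ ∑-distrib-+ (λ _ → 1) surplus ⟨
    ∑[ j < k ] (1 + surplus j)            ≡⟨ sum-cong-≗ (λ j → m+[n∸m]≡n (f≥1 j)) ⟩
    ∑[ j < k ] f j                        ≡⟨ ∑f≡k ⟩
    k                                     ≡⟨ +-identityʳ k ⟨
    k + 0                                 ∎)

T⇒indicator≡1 : ∀ {b} → T b → indicator b ≡ 1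
T⇒indicator≡1 {true} _ = refl

count≥1 : ∀ {k} (b : Fin k → Bool) i → T (b i) → 1 ≤ count k b
count≥1 b i t = subst (_≤ count _ b) (T⇒indicator≡1 t) (f[i]≤∑ (indicator ∘ b) i)

count≥2 : ∀ {k} (b : Fin k → Bool) {i j} → i ≢ j → T (b i) → T (b j) → 2 ≤ count k b
count≥2 b i≢j tᵢ tⱼ =
  subst (_≤ count _ b) (cong₂ _+_ (T⇒indicator≡1 tᵢ) (T⇒indicator≡1 tⱼ))
    (f[i]+f[j]≤∑ (indicator ∘ b) i≢j)

count≡0 : ∀ {k} (b : Fin k → Bool) → (∀ i → ¬ T (b i)) → count k b ≡ 0
count≡0 {zero}  b none = refl
count≡0 {suc k} b none with b fzero in eq
... | true  = contradiction (subst T (sym eq) tt) (none fzero)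
... | false = count≡0 (b ∘ fsuc) (none ∘ fsuc)

count≤1 : ∀ {k} (b : Fin k → Bool) → (∀ i j → T (b i) → T (b j) → i ≡ j) → count k b ≤ 1
count≤1 {zero}  b unique = z≤n
count≤1 {suc k} b unique with b fzero in eq
... | true  = ≤-reflexive (cong suc (count≡0 (b ∘ fsuc) (λ i t →
                 Fin.0≢1+n (unique fzero (fsuc i) (subst T (sym eq) tt) t))))
... | false = count≤1 (b ∘ fsuc) (λ i j tᵢ tⱼ → Fin.suc-injective (unique (fsuc i) (fsuc j) tᵢ tⱼ))

length-filter-map-upTo : ∀ (b : ℕ → Bool) f k →
  length (filter (T? ∘ b) (map f (upTo k))) ≡ count k (λ i → b (f (toℕ i)))
length-filter-map-upTo b f k rewrite map-upTo f k = go f k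
  where
  go : ∀ g k → length (filter (T? ∘ b) (applyUpTo g k)) ≡ count k (λ i → b (g (toℕ i)))
  go g zero = refl
  go g (suc k) with b (g 0)
  ... | true  = cong suc (go (g ∘ suc) k)
  ... | false = go (g ∘ suc) k

-- Cyclotomic cosets of 2 modulo an odd number

-- Parametrised by n′ = N - 1, so that Defs._mod_ at N unfolds to _%_.
module OddModulus (n′ : ℕ) (odd : Odd (suc n′)) where

  N : ℕ
  N = suc n′

  H : ℕ
  H = h N

  H>0 : 1 ≤ H
  H>0 = proj₁ (h-isOrder {N} odd)

  N∣2^H∸1 : N ∣ 2 ^ H ∸ 1
  N∣2^H∸1 = proj₂ (h-isOrder {N} odd)

  instance
    H-nonZero : NonZero H
    H-nonZero = >-nonZero H>0

  infixl 7 _·2^_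
  _·2^_ : ℕ → ℕ → ℕ
  x ·2^ j = x * 2 ^ j % N

  ·2^-< : ∀ x j → x ·2^ j < N
  ·2^-< x j = m%n<n (x * 2 ^ j) N

  ·2^-+ : ∀ x a b → x ·2^ a ·2^ b ≡ x ·2^ (a + b)
  ·2^-+ x a b = begin
    x * 2 ^ a % N * 2 ^ b % N ≡⟨ [m%d]*n%d≡m*n%d (x * 2 ^ a) (2 ^ b) N ⟩
    x * 2 ^ a * 2 ^ b % N     ≡⟨ cong (_% N) (*-assoc x (2 ^ a) (2 ^ b)) ⟩
    x * (2 ^ a * 2 ^ b) % N   ≡⟨ cong (λ y → x * y % N) (^-distribˡ-+-* 2 a b) ⟨
    x ·2^ (a + b)             ∎
    where open ≡-Reasoning

  ·2^-comm : ∀ x a b → x ·2^ a ·2^ b ≡ x ·2^ b ·2^ a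
  ·2^-comm x a b = trans (·2^-+ x a b) (trans (cong (x ·2^_) (+-comm a b)) (sym (·2^-+ x b a)))

  ∣*[2^j∸1]⇒·2^j≡% : ∀ x j → N ∣ x * (2 ^ j ∸ 1) → x ·2^ j ≡ x % N
  ∣*[2^j∸1]⇒·2^j≡% x j N∣ = sym (∣∸⇒%≡% N (m≤m*n x (2 ^ j) {{m^n≢0 2 j}})
    (subst (N ∣_) (sym (m*n∸m≡m*[n∸1] x (2 ^ j))) N∣))

  ·2^-*H : ∀ x q → x ·2^ (q * H) ≡ x % N
  ·2^-*H x zero    = cong (_% N) (*-identityʳ x)
  ·2^-*H x (suc q) = begin
    x ·2^ (H + q * H)   ≡⟨ ·2^-+ x H (q * H) ⟨
    x ·2^ H ·2^ (q * H) ≡⟨ ·2^-*H (x ·2^ H) q ⟩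
    x ·2^ H % N         ≡⟨ m%n%n≡m%n (x * 2 ^ H) N ⟩
    x ·2^ H             ≡⟨ ∣*[2^j∸1]⇒·2^j≡% x H (∣n⇒∣m*n x N∣2^H∸1) ⟩
    x % N               ∎
    where open ≡-Reasoning

  ·2^-%H : ∀ x j → x ·2^ (j % H) ≡ x ·2^ j
  ·2^-%H x j = begin
    x ·2^ (j % H)                 ≡⟨ m%n%n≡m%n (x * 2 ^ (j % H)) N ⟨
    x ·2^ (j % H) % N             ≡⟨ ·2^-*H (x ·2^ (j % H)) (j / H) ⟨
    x ·2^ (j % H) ·2^ (j / H * H) ≡⟨ ·2^-+ x (j % H) (j / H * H) ⟩
    x ·2^ (j % H + j / H * H)     ≡⟨ cong (x ·2^_) (m≡m%n+[m/n]*n j H) ⟨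
    x ·2^ j                       ∎
    where open ≡-Reasoning

  ·2^-inverse : ∀ {x} j → x < N → x ·2^ j ·2^ (j * (H ∸ 1)) ≡ x
  ·2^-inverse {x} j x<N = begin
    x ·2^ j ·2^ (j * (H ∸ 1)) ≡⟨ ·2^-+ x j (j * (H ∸ 1)) ⟩
    x ·2^ (j + j * (H ∸ 1))   ≡⟨ cong (x ·2^_) (*-suc j (H ∸ 1)) ⟨
    x ·2^ (j * suc (H ∸ 1))   ≡⟨ cong (λ e → x ·2^ (j * e)) (m+[n∸m]≡n H>0) ⟩
    x ·2^ (j * H)             ≡⟨ ·2^-*H x j ⟩
    x % N                     ≡⟨ m<n⇒m%n≡m x<N ⟩
    x                         ∎
    where open ≡-Reasoning

  ·2^-injective : ∀ j {x y} → x < N → y < N → x ·2^ j ≡ y ·2^ j → x ≡ y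
  ·2^-injective j {x} {y} x<N y<N eq = begin
    x                         ≡⟨ ·2^-inverse j x<N ⟨
    x ·2^ j ·2^ (j * (H ∸ 1)) ≡⟨ cong (_·2^ (j * (H ∸ 1))) eq ⟩
    y ·2^ j ·2^ (j * (H ∸ 1)) ≡⟨ ·2^-inverse j y<N ⟩
    y                         ∎
    where open ≡-Reasoning

  ·2^-permutation : ℕ → Permutation N N
  ·2^-permutation j = permutation (times j) (times (j * (H ∸ 1))) inverseˡ inverseʳ
    where
    times : ℕ → Fin N → Fin N
    times a x = fromℕ< (·2^-< (toℕ x) a)
    toℕ-times : ∀ a x → toℕ (times a x) ≡ toℕ x ·2^ a
    toℕ-times a x = Fin.toℕ-fromℕ< (·2^-< (toℕ x) a)
    inverseʳ : ∀ x → times (j * (H ∸ 1)) (times j x) ≡ x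
    inverseʳ x = Fin.toℕ-injective (begin
      toℕ (times (j * (H ∸ 1)) (times j x)) ≡⟨ toℕ-times (j * (H ∸ 1)) (times j x) ⟩
      toℕ (times j x) ·2^ (j * (H ∸ 1))     ≡⟨ cong (_·2^ (j * (H ∸ 1))) (toℕ-times j x) ⟩
      toℕ x ·2^ j ·2^ (j * (H ∸ 1))         ≡⟨ ·2^-inverse j (Fin.toℕ<n x) ⟩
      toℕ x                                 ∎)
      where open ≡-Reasoning
    inverseˡ : ∀ x → times j (times (j * (H ∸ 1)) x) ≡ x
    inverseˡ x = Fin.toℕ-injective (begin
      toℕ (times j (times (j * (H ∸ 1)) x)) ≡⟨ toℕ-times j (times (j * (H ∸ 1)) x) ⟩
      toℕ (times (j * (H ∸ 1)) x) ·2^ j     ≡⟨ cong (_·2^ j) (toℕ-times (j * (H ∸ 1)) x) ⟩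
      toℕ x ·2^ (j * (H ∸ 1)) ·2^ j         ≡⟨ ·2^-comm (toℕ x) (j * (H ∸ 1)) j ⟩
      toℕ x ·2^ j ·2^ (j * (H ∸ 1))         ≡⟨ ·2^-inverse j (Fin.toℕ<n x) ⟩
      toℕ x                                 ∎)
      where open ≡-Reasoning

  ∑-·2^-invariant : ∀ j (f : ℕ → ℕ) → ∑[ x < N ] f (toℕ x ·2^ j) ≡ ∑[ x < N ] f (toℕ x)
  ∑-·2^-invariant j f = sym (trans (∑-permute (f ∘ toℕ) (·2^-permutation j))
    (sum-cong-≗ {N} (λ x → cong f (Fin.toℕ-fromℕ< (·2^-< (toℕ x) j)))))

  isCosetMin⇒≤ : ∀ {x} → T (isCosetMin N x) → ∀ j → x ≤ x ·2^ j
  isCosetMin⇒≤ {x} min j = subst (x ≤_) (·2^-%H x j)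
    (≤ᵇ⇒≤ x (x ·2^ (j % H)) (All.lookup (to (T-foldr-∧ (λ i → x ≤ᵇ x ·2^ i) (upTo N)) min)
      (∈-upTo⁺ (<-≤-trans (m%n<n j H) (h≤ {N} odd)))))

  ≤⇒isCosetMin : ∀ {x} → (∀ j → x ≤ x ·2^ j) → T (isCosetMin N x)
  ≤⇒isCosetMin {x} x≤ =
    from (T-foldr-∧ (λ i → x ≤ᵇ x ·2^ i) (upTo N)) (All.tabulate (λ {j} _ → ≤⇒≤ᵇ (x≤ j)))

  cosetMin-unique : ∀ {u} δ → u < N → T (isCosetMin N u) → T (isCosetMin N (u ·2^ δ)) → u ·2^ δ ≡ u
  cosetMin-unique {u} δ u<N min-u min-v = ≤-antisym
    (subst (u ·2^ δ ≤_) (·2^-inverse δ u<N) (isCosetMin⇒≤ min-v (δ * (H ∸ 1))))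
    (isCosetMin⇒≤ min-u δ)

  minExponent : ℕ → ℕ
  minExponent x = argmin (x ·2^_) 0 (upTo H)

  minExponent-least : ∀ x j → x ·2^ minExponent x ≤ x ·2^ j
  minExponent-least x j = subst (x ·2^ minExponent x ≤_) (·2^-%H x j)
    (All.lookup (f[argmin]≤f[xs] {f = x ·2^_} 0 (upTo H)) (∈-upTo⁺ (m%n<n j H)))

  isCosetMin-minExponent : ∀ x → T (isCosetMin N (x ·2^ minExponent x))
  isCosetMin-minExponent x =
    ≤⇒isCosetMin (λ j → subst (x ·2^ minExponent x ≤_) (sym (·2^-+ x (minExponent x) j))
                                (minExponent-least x (minExponent x + j)))

  FullOrbit : ℕ → Set
  FullOrbit x = ∀ t → 0 < t → t < H → x ·2^ t ≢ x

  atCosetMin : ℕ → Fin H → Bool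
  atCosetMin x j = isCosetMin N (x ·2^ toℕ j)

  minCount : ℕ → ℕ
  minCount x = count H (atCosetMin x)

  isCosetMin-modᶠ : ∀ x j → T (isCosetMin N (x ·2^ j)) → T (atCosetMin x (j modᶠ H))
  isCosetMin-modᶠ x j =
    subst (T ∘ isCosetMin N) (sym (trans (cong (x ·2^_) (Fin.toℕ-fromℕ< (m%n<n j H))) (·2^-%H x j)))

  minCount≥1 : ∀ x → 1 ≤ minCount x
  minCount≥1 x =
    count≥1 (atCosetMin x) (minExponent x modᶠ H) (isCosetMin-modᶠ x _ (isCosetMin-minExponent x))

  minCount≥2 : ∀ {x t} → 0 < t → t < H → x ·2^ t ≡ x → 2 ≤ minCount x
  minCount≥2 {x} {t} t>0 t<H fixed =
    count≥2 (atCosetMin x) distinct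
      (isCosetMin-modᶠ x (t + a) (subst (T ∘ isCosetMin N) (sym shifted) minₐ))
      (isCosetMin-modᶠ x a minₐ)
    where
    a : ℕ
    a = minExponent x
    minₐ : T (isCosetMin N (x ·2^ a))
    minₐ = isCosetMin-minExponent x
    shifted : x ·2^ (t + a) ≡ x ·2^ a
    shifted = trans (sym (·2^-+ x t a)) (cong (_·2^ a) fixed)
    distinct : (t + a) modᶠ H ≢ a modᶠ H
    distinct eq = <⇒≱ t<H (∣⇒≤ {{>-nonZero t>0}} (subst (H ∣_) (m+n∸n≡m t a) (%≡%⇒∣∸ a (t + a) H
      (trans (sym (Fin.toℕ-fromℕ< _)) (trans (cong toℕ (sym eq)) (Fin.toℕ-fromℕ< _))))))

  full⇒minCount≤1 : ∀ {x} → x < N → FullOrbit x → minCount x ≤ 1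
  full⇒minCount≤1 {x} x<N full = count≤1 (atCosetMin x) unique
    where
    no-two-minima : ∀ {a b} → a < b → b < H →
                    T (isCosetMin N (x ·2^ a)) → T (isCosetMin N (x ·2^ b)) → ⊥
    no-two-minima {a} {b} a<b b<H minₐ min_b =
      full (b ∸ a) (m<n⇒0<n∸m a<b) (≤-<-trans (m∸n≤m b a) b<H)
        (·2^-injective a (·2^-< x (b ∸ a)) x<N (trans (·2^-comm x (b ∸ a) a)
          (cosetMin-unique (b ∸ a) (·2^-< x a) minₐ (subst (T ∘ isCosetMin N) (sym a+[b∸a]) min_b))))
      where
      a+[b∸a] : x ·2^ a ·2^ (b ∸ a) ≡ x ·2^ b
      a+[b∸a] = trans (·2^-+ x a (b ∸ a)) (cong (x ·2^_) (m+[n∸m]≡n (<⇒≤ a<b)))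
    unique : ∀ i j → T (atCosetMin x i) → T (atCosetMin x j) → i ≡ j
    unique i j minᵢ minⱼ with <-cmp (toℕ i) (toℕ j)
    ... | tri< i<j _ _ = ⊥-elim (no-two-minima i<j (Fin.toℕ<n j) minᵢ minⱼ)
    ... | tri≈ _ i≡j _ = Fin.toℕ-injective i≡j
    ... | tri> _ _ j<i = ⊥-elim (no-two-minima j<i (Fin.toℕ<n i) minⱼ minᵢ)

  r≡count : r N ≡ count n′ (isCosetMin N ∘ suc ∘ toℕ)
  r≡count = length-filter-map-upTo (isCosetMin N) suc n′

  -- The permuted sum over all residues starts with the same term, for 0 ·2^ j = 0.
  count-·2^-invariant : ∀ j → count n′ (λ x → isCosetMin N (suc (toℕ x) ·2^ j))
                            ≡ count n′ (isCosetMin N ∘ suc ∘ toℕ)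
  count-·2^-invariant j =
    +-cancelˡ-≡ (indicator (isCosetMin N 0)) _ _ (∑-·2^-invariant j (indicator ∘ isCosetMin N))

  ∑minCount≡H*r : ∑[ x < n′ ] minCount (suc (toℕ x)) ≡ H * r N
  ∑minCount≡H*r = begin
    ∑[ x < n′ ] ∑[ j < H ] indicator (atCosetMin (suc (toℕ x)) j)
      ≡⟨ ∑-comm {n′} {H} (λ x j → indicator (atCosetMin (suc (toℕ x)) j)) ⟩
    ∑[ j < H ] count n′ (λ x → isCosetMin N (suc (toℕ x) ·2^ toℕ j))
      ≡⟨ sum-cong-≗ {H} (count-·2^-invariant ∘ toℕ) ⟩
    ∑[ j < H ] count n′ (isCosetMin N ∘ suc ∘ toℕ)
      ≡⟨ ∑-const H _ ⟩
    H * count n′ (isCosetMin N ∘ suc ∘ toℕ)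
      ≡⟨ cong (H *_) r≡count ⟨
    H * r N
      ∎
    where open ≡-Reasoning

  r*H≡n′⇔fullOrbits : r N * H ≡ n′ ⇔ (∀ x → 0 < x → x < N → FullOrbit x)
  r*H≡n′⇔fullOrbits = mk⇔ allFull allMinCount≡1
    where
    allFull : r N * H ≡ n′ → ∀ x → 0 < x → x < N → FullOrbit x
    allFull rH (suc x) _ x<N t t>0 t<H fixed = <⇒≱ (minCount≥2 t>0 t<H fixed) (≤-reflexive minCount≡1)
      where
      minCount≡1 : minCount (suc x) ≡ 1
      minCount≡1 = subst (λ y → minCount (suc y) ≡ 1) (Fin.toℕ-fromℕ< (s<s⁻¹ x<N))
        (∑≡k⇒all≡1 (minCount ∘ suc ∘ toℕ) (minCount≥1 ∘ suc ∘ toℕ)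
          (trans ∑minCount≡H*r (trans (*-comm H (r N)) rH)) (fromℕ< (s<s⁻¹ x<N)))
    allMinCount≡1 : (∀ x → 0 < x → x < N → FullOrbit x) → r N * H ≡ n′
    allMinCount≡1 full = begin
      r N * H                           ≡⟨ *-comm (r N) H ⟩
      H * r N                           ≡⟨ ∑minCount≡H*r ⟨
      ∑[ x < n′ ] minCount (suc (toℕ x)) ≡⟨ sum-cong-≗ {n′} minCount≡1 ⟩
      ∑[ x < n′ ] 1                     ≡⟨ ∑-const n′ 1 ⟩
      n′ * 1                            ≡⟨ *-identityʳ n′ ⟩
      n′                                ∎
      where
      open ≡-Reasoning
      minCount≡1 : ∀ x → minCount (suc (toℕ x)) ≡ 1
      minCount≡1 x =
        ≤-antisym (full⇒minCount≤1 {suc (toℕ x)} x<N (full _ z<s x<N)) (minCount≥1 (suc (toℕ x)))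
        where
        x<N : suc (toℕ x) < N
        x<N = s<s (Fin.toℕ<n x)

  ∣⇒h≤H : ∀ {d} → d ∣ N → h d ≤ H
  ∣⇒h≤H d∣N = h-least (odd-∣ d∣N odd) H>0 (∣-trans d∣N N∣2^H∸1)

  fullCofactor⇒H≤h : ∀ {e d} → N ≡ e * d → 1 < d → FullOrbit e → H ≤ h d
  fullCofactor⇒H≤h {e} {d} N≡e*d 1<d full = ≮⇒≥ (λ hd<H → full (h d) hd>0 hd<H e·2^hd≡e)
    where
    odd-d : Odd d
    odd-d = odd-∣ (divides e N≡e*d) odd
    hd>0 : 1 ≤ h d
    hd>0 = proj₁ (h-isOrder {d} odd-d)
    e·2^hd≡e : e ·2^ h d ≡ e
    e·2^hd≡e = trans
      (∣*[2^j∸1]⇒·2^j≡% e (h d)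
        (subst (_∣ e * (2 ^ h d ∸ 1)) (sym N≡e*d) (*-monoʳ-∣ e (proj₂ (h-isOrder {d} odd-d)))))
      (m<n⇒m%n≡m (proj₂ (*-cofactor-< N≡e*d 1<d)))

  -- d = N / gcd(x, N) divides x (2^t - 1) / gcd(x, N), and is coprime to x / gcd(x, N).
  fixed⇒divisor : ∀ {x t} → 0 < x → x < N → 0 < t → x ·2^ t ≡ x → ∃ λ d → d ∣ N × 1 < d × h d ≤ t
  fixed⇒divisor {x} {t} x>0 x<N t>0 fixed =
    d , quotient-∣ g∣N , quotient>1 g∣N g<N , h-least (odd-∣ (quotient-∣ g∣N) odd) t>0 d∣2^t∸1
    where
    g : ℕ
    g = gcd x N
    g∣x : g ∣ x
    g∣x = gcd[m,n]∣m x N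
    g∣N : g ∣ N
    g∣N = gcd[m,n]∣n x N
    instance
      g-nonZero : NonZero g
      g-nonZero = ≢-nonZero (gcd[m,n]≢0 x N (inj₂ λ ()))
    d : ℕ
    d = quotient g∣N
    x′ : ℕ
    x′ = quotient g∣x
    g<N : g < N
    g<N = ≤-<-trans (∣⇒≤ {{>-nonZero x>0}} g∣x) x<N
    N∣x*[2^t∸1] : N ∣ x * (2 ^ t ∸ 1)
    N∣x*[2^t∸1] = subst (N ∣_) (m*n∸m≡m*[n∸1] x (2 ^ t))
      (%≡%⇒∣∸ x (x * 2 ^ t) N (trans (m<n⇒m%n≡m x<N) (sym fixed)))
    x*[2^t∸1]≡x′*[2^t∸1]*g : x * (2 ^ t ∸ 1) ≡ x′ * (2 ^ t ∸ 1) * g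
    x*[2^t∸1]≡x′*[2^t∸1]*g = begin
      x * (2 ^ t ∸ 1)         ≡⟨ cong (_* (2 ^ t ∸ 1)) (m∣n⇒n≡quotient*m g∣x) ⟩
      x′ * g * (2 ^ t ∸ 1)    ≡⟨ *-assoc x′ g _ ⟩
      x′ * (g * (2 ^ t ∸ 1))  ≡⟨ cong (x′ *_) (*-comm g _) ⟩
      x′ * ((2 ^ t ∸ 1) * g)  ≡⟨ *-assoc x′ _ g ⟨
      x′ * (2 ^ t ∸ 1) * g    ∎
      where open ≡-Reasoning
    d∣x′*[2^t∸1] : d ∣ x′ * (2 ^ t ∸ 1)
    d∣x′*[2^t∸1] = *-cancelʳ-∣ g
      (subst₂ _∣_ (m∣n⇒n≡quotient*m g∣N) x*[2^t∸1]≡x′*[2^t∸1]*g N∣x*[2^t∸1])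
    d∣2^t∸1 : d ∣ 2 ^ t ∸ 1
    d∣2^t∸1 = coprime-divisor
      (subst₂ Coprime (n/m≡quotient g∣N) (n/m≡quotient g∣x) (coprime-sym (coprime-/gcd x N)))
      d∣x′*[2^t∸1]

  r*H≡n′⇔orders : r N * H ≡ n′ ⇔ (∀ d → d ∣ N → 1 < d → h d ≡ H)
  r*H≡n′⇔orders = mk⇔ sameOrders (from r*H≡n′⇔fullOrbits ∘ fullOrbits)
    where
    sameOrders : r N * H ≡ n′ → ∀ d → d ∣ N → 1 < d → h d ≡ H
    sameOrders rH d d∣N@(divides e N≡e*d) 1<d =
      ≤-antisym (∣⇒h≤H d∣N) (fullCofactor⇒H≤h N≡e*d 1<d (to r*H≡n′⇔fullOrbits rH e e>0 e<N))
      where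
      e>0 : 0 < e
      e>0 = proj₁ (*-cofactor-< N≡e*d 1<d)
      e<N : e < N
      e<N = proj₂ (*-cofactor-< N≡e*d 1<d)
    fullOrbits : (∀ d → d ∣ N → 1 < d → h d ≡ H) → ∀ x → 0 < x → x < N → FullOrbit x
    fullOrbits same x x>0 x<N t t>0 t<H fixed
      with d , d∣N , 1<d , hd≤t ← fixed⇒divisor x>0 x<N t>0 fixed
      = <⇒≱ t<H (subst (_≤ t) (same d d∣N 1<d) hd≤t)

-- Divisors of a product of prime powers

∏^ : ∀ k → (Fin k → ℕ) → (Fin k → ℕ) → ℕ
∏^ k p e = prod k (λ j → p j ^ e j)

prime>1 : ∀ {p} → Prime p → 1 < p
prime>1 {p} p-prime = nonTrivial⇒n>1 p {{prime⇒nonTrivial p-prime}}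

prime^>0 : ∀ {p} → Prime p → ∀ e → 0 < p ^ e
prime^>0 {p} p-prime = m^n>0 p {{prime⇒nonZero p-prime}}

prime∣^⇒≡ : ∀ {q p} e → Prime q → Prime p → q ∣ p ^ e → q ≡ p
prime∣^⇒≡ zero q-prime _ q∣1 = contradiction (∣1⇒≡1 q∣1) (>⇒≢ (prime>1 q-prime))
prime∣^⇒≡ {q} {p} (suc e) q-prime p-prime q∣p^1+e with euclidsLemma p (p ^ e) q-prime q∣p^1+e
... | inj₂ q∣p^e = prime∣^⇒≡ e q-prime p-prime q∣p^e
... | inj₁ q∣p with prime⇒irreducible p-prime q∣p
...   | inj₁ q≡1 = contradiction q≡1 (>⇒≢ (prime>1 q-prime))
...   | inj₂ q≡p = q≡p

prime∣∏^⇒≡ : ∀ {q} k (p e : Fin k → ℕ) → (∀ j → Prime (p j)) → Prime q → q ∣ ∏^ k p e → ∃ λ j → q ≡ p j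
prime∣∏^⇒≡ zero p e _ q-prime q∣1 = contradiction (∣1⇒≡1 q∣1) (>⇒≢ (prime>1 q-prime))
prime∣∏^⇒≡ (suc k) p e primes q-prime q∣∏ with euclidsLemma (p fzero ^ e fzero) _ q-prime q∣∏
... | inj₁ q∣p₀^e₀ = fzero , prime∣^⇒≡ (e fzero) q-prime (primes fzero) q∣p₀^e₀
... | inj₂ q∣rest with j , q≡pⱼ ← prime∣∏^⇒≡ k (p ∘ fsuc) (e ∘ fsuc) (primes ∘ fsuc) q-prime q∣rest
  = fsuc j , q≡pⱼ

∤prime⇒coprime : ∀ {q d} → Prime q → ¬ q ∣ d → Coprime d q
∤prime⇒coprime q-prime q∤d (c∣d , c∣q) with prime⇒irreducible q-prime c∣q
... | inj₁ c≡1 = c≡1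
... | inj₂ refl = contradiction c∣d q∤d

∣prime^*m⇒≡prime^*∣m : ∀ {q m} → Prime q → ¬ q ∣ m → ∀ e {d} → d ∣ q ^ e * m →
                       ∃₂ λ a d′ → a ≤ e × d′ ∣ m × d ≡ q ^ a * d′
∣prime^*m⇒≡prime^*∣m {q} {m} _ _ zero {d} d∣m =
  0 , d , z≤n , subst (d ∣_) (+-identityʳ m) d∣m , sym (+-identityʳ d)
∣prime^*m⇒≡prime^*∣m {q} {m} q-prime q∤m (suc e) {d} d∣ with q ∣? d
... | yes (divides d₁ d≡d₁*q)
  with a , d′ , a≤e , d′∣m , d₁≡ ← ∣prime^*m⇒≡prime^*∣m q-prime q∤m e {d₁}
         (*-cancelʳ-∣ q {{prime⇒nonZero q-prime}}
           (subst₂ _∣_ d≡d₁*q (trans (*-assoc q (q ^ e) m) (*-comm q (q ^ e * m))) d∣))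
  = suc a , d′ , s≤s a≤e , d′∣m , (begin
    d                ≡⟨ d≡d₁*q ⟩
    d₁ * q           ≡⟨ cong (_* q) d₁≡ ⟩
    q ^ a * d′ * q   ≡⟨ *-comm (q ^ a * d′) q ⟩
    q * (q ^ a * d′) ≡⟨ *-assoc q (q ^ a) d′ ⟨
    q * q ^ a * d′   ∎)
  where open ≡-Reasoning
... | no q∤d
  with a , d′ , a≤e , d′∣m , d≡ ← ∣prime^*m⇒≡prime^*∣m q-prime q∤m e
         (coprime-divisor (∤prime⇒coprime q-prime q∤d) (subst (d ∣_) (*-assoc q (q ^ e) m) d∣))
  = a , d′ , m≤n⇒m≤1+n a≤e , d′∣m , d≡

prime₀∤∏^-tail : ∀ k (p e : Fin (suc k) → ℕ) → (∀ j → Prime (p j)) → Injective _≡_ _≡_ p →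
                 ¬ p fzero ∣ ∏^ k (p ∘ fsuc) (e ∘ fsuc)
prime₀∤∏^-tail k p e primes injective p₀∣tail
  with j , p₀≡pⱼ ← prime∣∏^⇒≡ k (p ∘ fsuc) (e ∘ fsuc) (primes ∘ fsuc) (primes fzero) p₀∣tail
  = Fin.0≢1+n (injective p₀≡pⱼ)

∣∏^⇒≡∏^ : ∀ k (p l : Fin k → ℕ) → (∀ j → Prime (p j)) → Injective _≡_ _≡_ p →
          ∀ {d} → d ∣ ∏^ k p l → ∃ λ i → (∀ j → i j ≤ l j) × d ≡ ∏^ k p i
∣∏^⇒≡∏^ zero p l _ _ d∣1 = (λ ()) , (λ ()) , ∣1⇒≡1 d∣1
∣∏^⇒≡∏^ (suc k) p l primes injective d∣
  with a , d′ , a≤l₀ , d′∣tail , d≡ ←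
         ∣prime^*m⇒≡prime^*∣m (primes fzero) (prime₀∤∏^-tail k p l primes injective) (l fzero) d∣
  with i , i≤l , d′≡ ←
         ∣∏^⇒≡∏^ k (p ∘ fsuc) (l ∘ fsuc) (primes ∘ fsuc) (Fin.suc-injective ∘ injective) d′∣tail
  = (λ { fzero → a ; (fsuc j) → i j }) , (λ { fzero → a≤l₀ ; (fsuc j) → i≤l j }) ,
    trans d≡ (cong (p fzero ^ a *_) d′≡)

^-monoʳ-∣ : ∀ q {a b} → a ≤ b → q ^ a ∣ q ^ b
^-monoʳ-∣ q {a} {b} a≤b = divides (q ^ (b ∸ a)) (begin
  q ^ b             ≡⟨ cong (q ^_) (m+[n∸m]≡n a≤b) ⟨
  q ^ (a + (b ∸ a)) ≡⟨ ^-distribˡ-+-* q a (b ∸ a) ⟩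
  q ^ a * q ^ (b ∸ a) ≡⟨ *-comm (q ^ a) _ ⟩
  q ^ (b ∸ a) * q ^ a ∎)
  where open ≡-Reasoning

∏^-monoʳ-∣ : ∀ k (p : Fin k → ℕ) {i l} → (∀ j → i j ≤ l j) → ∏^ k p i ∣ ∏^ k p l
∏^-monoʳ-∣ zero    p i≤l = ∣-refl
∏^-monoʳ-∣ (suc k) p i≤l =
  *-pres-∣ (^-monoʳ-∣ (p fzero) (i≤l fzero)) (∏^-monoʳ-∣ k (p ∘ fsuc) (i≤l ∘ fsuc))

∏^>0 : ∀ k (p i : Fin k → ℕ) → (∀ j → Prime (p j)) → 0 < ∏^ k p i
∏^>0 zero    p i _      = z<s
∏^>0 (suc k) p i primes =
  *-mono-≤ (prime^>0 (primes fzero) (i fzero)) (∏^>0 k (p ∘ fsuc) (i ∘ fsuc) (primes ∘ fsuc))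

∃≢0⇒∏^>1 : ∀ k (p i : Fin k → ℕ) → (∀ j → Prime (p j)) → (∃ λ j → i j ≢ 0) → 1 < ∏^ k p i
∃≢0⇒∏^>1 (suc k) p i primes (fzero , i₀≢0) =
  *-mono-≤ (prime^>1 (primes fzero) (i fzero) i₀≢0) (∏^>0 k (p ∘ fsuc) (i ∘ fsuc) (primes ∘ fsuc))
  where
  prime^>1 : ∀ {q} → Prime q → ∀ a → a ≢ 0 → 1 < q ^ a
  prime^>1 q-prime zero    a≢0 = contradiction refl a≢0
  prime^>1 q-prime (suc a) _   = *-mono-≤ (prime>1 q-prime) (prime^>0 q-prime a)
∃≢0⇒∏^>1 (suc k) p i primes (fsuc j , iⱼ≢0) =
  *-mono-≤ (prime^>0 (primes fzero) (i fzero))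
           (∃≢0⇒∏^>1 k (p ∘ fsuc) (i ∘ fsuc) (primes ∘ fsuc) (j , iⱼ≢0))

∏^≢1⇒∃≢0 : ∀ k (p i : Fin k → ℕ) → ∏^ k p i ≢ 1 → ∃ λ j → i j ≢ 0
∏^≢1⇒∃≢0 zero p i ∏≢1 = contradiction refl ∏≢1
∏^≢1⇒∃≢0 (suc k) p i ∏≢1 with i fzero in i₀≡
... | suc _ = fzero , λ i₀≡0 → 0≢1+n (trans (sym i₀≡0) i₀≡)
... | zero with j , iⱼ≢0 ← ∏^≢1⇒∃≢0 k (p ∘ fsuc) (i ∘ fsuc) (∏≢1 ∘ trans (+-identityʳ _))
  = fsuc j , iⱼ≢0

theorem2 : (n k : ℕ) (p l : Fin k → ℕ) →
    (∀ j → Prime (p j)) → Injective _≡_ _≡_ p → (∀ j → 1 ≤ l j) →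
    n ≡ prod k (λ j → p j ^ l j) → Odd n → Composite n →
    (Overpseudoprime n ⇔
      ((i : Fin k → ℕ) → (∀ j → i j ≤ l j) → (∃ λ j → i j ≢ 0) →
        h n ≡ h (prod k (λ j → p j ^ i j))))
theorem2 zero _ _ _ _ _ _ _ () _
-- The exponents l j need not be positive.
theorem2 (suc n′) k p l primes injective _ n≡∏ odd composite = mk⇔
  (λ { (_ , _ , n≡r*h+1) → exponentOrders (to r*H≡n′⇔orders (to suc≡+1⇔≡ n≡r*h+1)) })
  (λ same → odd , composite , from suc≡+1⇔≡ (from r*H≡n′⇔orders (divisorOrders same)))
  where
  open OddModulus n′ odd
  exponentOrders : (∀ d → d ∣ N → 1 < d → h d ≡ H) →
                   ∀ i → (∀ j → i j ≤ l j) → (∃ λ j → i j ≢ 0) → H ≡ h (∏^ k p i)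
  exponentOrders same i i≤l i≢0 =
    sym (same (∏^ k p i) (subst (∏^ k p i ∣_) (sym n≡∏) (∏^-monoʳ-∣ k p i≤l))
              (∃≢0⇒∏^>1 k p i primes i≢0))
  divisorOrders : (∀ i → (∀ j → i j ≤ l j) → (∃ λ j → i j ≢ 0) → H ≡ h (∏^ k p i)) →
                  ∀ d → d ∣ N → 1 < d → h d ≡ H
  divisorOrders same d d∣N 1<d
    with i , i≤l , d≡∏ ← ∣∏^⇒≡∏^ k p l primes injective (subst (d ∣_) n≡∏ d∣N)
    = trans (cong h d≡∏) (sym (same i i≤l (∏^≢1⇒∃≢0 k p i (>⇒≢ 1<d ∘ trans d≡∏))))
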